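{- Let $G$ be a $(K_8, K_{2,2,2,2,2}, 5)$-cockade and let $x, y$ be nonadjacent vertices of $G$. Then the graph $G + xy$ obtained by adding the edge $xy$ has a $K_9^=$ minor.
   Context: All graphs are finite and simple. $K_9^=$ denotes $K_9$ with two edges removed; "has a $K_9^=$ minor" means contains as a minor at least one of the two nonisomorphic graphs obtained from $K_9$ by deleting two edges. An $(H_1,H_2,k)$-cockade is defined recursively: every graph isomorphic to $H_1$ or $H_2$ is one, and the graph obtained from two $(H_1,H_2,k)$-cockades by identifying a $k$-clique of one with a $k$-clique of the other is one; every cockade arises this way. $K_{2,2,2,2,2}$ is the complete 5-partite graph with all parts of size 2. -}

module Defs where

open import Data.Nat using (ℕ; _/_)
open import Data.Fin using (Fin; toℕ; _≟_)
open import Data.Bool using (Bool; true; false; not; _∧_; _∨_)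
open import Data.Maybe using (Maybe; just)
open import Data.Product using (Σ; ∃; ∃₂; _×_; _,_)
open import Data.Sum using (_⊎_)
open import Relation.Nullary using (¬_; ⌊_⌋)
open import Relation.Binary.PropositionalEquality using (_≡_; _≢_)
open import Function.Bundles using (_⇔_)
open import Function.Definitions using (Injective)
import Data.Nat as ℕ

-- A finite graph on vertex set Fin n, given by a Boolean adjacency matrix.
-- (Simplicity -- symmetry and irreflexivity -- is not a field; every graph
-- isomorphic to K8 / K_{2,2,2,2,2}, and every clique-sum of such, is simple.)
record Graph : Set where
  field
    n   : ℕ
    adj : Fin n → Fin n → Bool
open Graph public

E : (G : Graph) → Fin (n G) → Fin (n G) → Set
E G u v = adj G u v ≡ true

eqB : ∀ {m} → Fin m → Fin m → Bool
eqB u v = ⌊ u ≟ v ⌋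

multipartite : (m : ℕ) → (Fin m → ℕ) → Graph
multipartite m col = record { n = m ; adj = λ u v → not ⌊ col u ℕ.≟ col v ⌋ }

K8 : Graph
K8 = multipartite 8 toℕ

K22222 : Graph
K22222 = multipartite 10 (λ u → toℕ u / 2)

samePair : Fin 9 → Fin 9 → Fin 9 → Fin 9 → Bool
samePair a b u v = (eqB u a ∧ eqB v b) ∨ (eqB u b ∧ eqB v a)

K9minus : Fin 9 → Fin 9 → Fin 9 → Fin 9 → Graph
K9minus a b c d = record
  { n = 9
  ; adj = λ u v → not (eqB u v) ∧ not (samePair a b u v) ∧ not (samePair c d u v) }

addEdge : (G : Graph) → Fin (n G) → Fin (n G) → Graph
addEdge G x y = record
  { n = n G
  ; adj = λ u v → adj G u v ∨ (eqB u x ∧ eqB v y) ∨ (eqB u y ∧ eqB v x) }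

data PathIn (G : Graph) (P : Fin (n G) → Set) : Fin (n G) → Fin (n G) → Set where
  here : ∀ {u} → P u → PathIn G P u u
  step : ∀ {u w v} → P u → E G u w → PathIn G P w v → PathIn G P u v

-- H is a minor of G: a model with branch sets given by a partial map
-- V(G) → V(H) (vertex v lies in branch set of i iff β v ≡ just i);
-- branch sets are thus disjoint; they are required nonempty, connected,
-- and adjacent whenever the corresponding vertices of H are.
record MinorModel (H G : Graph) : Set where
  field
    β         : Fin (n G) → Maybe (Fin (n H))
    nonempty  : ∀ i → ∃ λ v → β v ≡ just i
    connected : ∀ i u v → β u ≡ just i → β v ≡ just i →
                PathIn G (λ w → β w ≡ just i) u v
    edges     : ∀ i j → E H i j →
                ∃₂ λ u v → β u ≡ just i × β v ≡ just j × E G u v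

IsMinor : Graph → Graph → Set
IsMinor H G = MinorModel H G

HasK9=Minor : Graph → Set
HasK9=Minor G = Σ (Fin 9) λ a → Σ (Fin 9) λ b → Σ (Fin 9) λ c → Σ (Fin 9) λ d →
  a ≢ b × c ≢ d × samePair a b c d ≡ false × IsMinor (K9minus a b c d) G

record Iso (G H : Graph) : Set where
  field
    to      : Fin (n G) → Fin (n H)
    from    : Fin (n H) → Fin (n G)
    from-to : ∀ v → from (to v) ≡ v
    to-from : ∀ w → to (from w) ≡ w
    pres    : ∀ u v → adj G u v ≡ adj H (to u) (to v)

-- G is obtained (up to isomorphism) from G₁ and G₂ by identifying a
-- k-clique c₁ of G₁ with a k-clique c₂ of G₂ (c₁ i identified with c₂ i);
-- f₁, f₂ embed G₁, G₂ into G.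
record CliqueSum (k : ℕ) (G₁ G₂ G : Graph) : Set where
  field
    c₁ : Fin k → Fin (n G₁)
    c₂ : Fin k → Fin (n G₂)
    c₁-inj : Injective _≡_ _≡_ c₁
    c₂-inj : Injective _≡_ _≡_ c₂
    c₁-clique : ∀ i j → i ≢ j → E G₁ (c₁ i) (c₁ j)
    c₂-clique : ∀ i j → i ≢ j → E G₂ (c₂ i) (c₂ j)
    f₁ : Fin (n G₁) → Fin (n G)
    f₂ : Fin (n G₂) → Fin (n G)
    f₁-inj : Injective _≡_ _≡_ f₁
    f₂-inj : Injective _≡_ _≡_ f₂
    glued   : ∀ i → f₁ (c₁ i) ≡ f₂ (c₂ i)
    meet    : ∀ a b → f₁ a ≡ f₂ b → ∃ λ i → a ≡ c₁ i × b ≡ c₂ i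
    cover   : ∀ v → (∃ λ a → f₁ a ≡ v) ⊎ (∃ λ b → f₂ b ≡ v)
    edges   : ∀ u v → E G u v ⇔
                ((∃₂ λ a b → f₁ a ≡ u × f₁ b ≡ v × E G₁ a b) ⊎
                 (∃₂ λ a b → f₂ a ≡ u × f₂ b ≡ v × E G₂ a b))

data Cockade (H₁ H₂ : Graph) (k : ℕ) : Graph → Set where
  base₁ : ∀ {G} → Iso G H₁ → Cockade H₁ H₂ k G
  base₂ : ∀ {G} → Iso G H₂ → Cockade H₁ H₂ k G
  glue  : ∀ {G₁ G₂ G} → Cockade H₁ H₂ k G₁ → Cockade H₁ H₂ k G₂ →
          CliqueSum k G₁ G₂ G → Cockade H₁ H₂ k G

-- K8 has no non-edge, and a non-edge of K_{2,2,2,2,2} is one of its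
-- parts, for which a K9= model is checked by computation. Let G be glued from G₁ and G₂ along a
-- 5-clique C. A non-edge inside one side is handled by that side. Otherwise x ∈ G₁ − C and
-- y ∈ G₂ − C. If x misses some c ∈ C, a path from y through G₂ − C to a neighbour of c (such
-- paths exist in every cockade) is contracted into c, so G + xy has the minor G₁ + xc. If x and y
-- both dominate C, the 6-cliques C + x and C + y extend to a K8 in G₁ and a K7 in G₂, which
-- together with the contracted edge xy form a K9=.
module Submission where

open import Defs
open import Data.Nat as ℕ using (ℕ; _/_; _+_; _∸_)
open import Data.Nat.DivMod using (_mod_)
open import Data.Fin as Fin using (Fin; zero; suc; toℕ; #_; _≟_)
open import Data.Fin.Properties using (any?; all?; ¬∀⟶∃¬; pigeonhole; <⇒≢; <⇒notInjective; toℕ-injective; punchInᵢ≢i)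
open import Data.Bool as Bool using (Bool; true; false; _∧_; _∨_)
open import Data.Bool.Properties using (∨-zeroʳ; ¬-not)
open import Data.Maybe using (Maybe; just; nothing; _>>=_)
open import Data.Maybe.Properties using (≡-dec)
open import Data.Product using (Σ; ∃; ∃₂; _×_; _,_; proj₁; proj₂)
open import Data.Sum using (_⊎_; inj₁; inj₂)
open import Data.Empty using (⊥-elim)
open import Data.List as List using (List)
open import Data.List.Membership.Propositional using (_∈_)
open import Data.List.Membership.Propositional.Properties using (∈-map⁺; ∈-map⁻)
open import Data.List.Relation.Unary.Any using (here; there)
open import Data.Vec.Functional using (Vector; []; _∷_)
open import Relation.Nullary using (¬_; Dec; yes; no)
open import Relation.Nullary.Decidable using (from-yes; _→-dec_; _×-dec_; _⊎-dec_; ¬?)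
open import Relation.Binary.PropositionalEquality using (_≡_; _≢_; refl; sym; trans; cong; subst; subst₂)
open import Function using (_∘_)
open import Function.Bundles using (Equivalence)
open import Function.Definitions using (Injective)

Undirected : Graph → Set
Undirected G = ∀ u v → E G u v → E G v u

Homomorphism : (H G : Graph) → (Fin (n H) → Fin (n G)) → Set
Homomorphism H G f = ∀ u v → E H u v → E G (f u) (f v)

Clique : (G : Graph) {m : ℕ} → Vector (Fin (n G)) m → Set
Clique G h = ∀ i j → i ≢ j → E G (h i) (h j)

∨-true : ∀ {a b} → a ∨ b ≡ true → a ≡ true ⊎ b ≡ true
∨-true {true}  _ = inj₁ refl
∨-true {false} e = inj₂ e

∧-true : ∀ {a b} → a ∧ b ≡ true → a ≡ true × b ≡ true
∧-true {true} {true} _ = refl , refl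

eqB-refl : ∀ {m} (u : Fin m) → eqB u u ≡ true
eqB-refl u with u ≟ u
... | yes _   = refl
... | no u≢u = ⊥-elim (u≢u refl)

eqB⇒≡ : ∀ {m} {u v : Fin m} → eqB u v ≡ true → u ≡ v
eqB⇒≡ {u = u} {v} e with u ≟ v
... | yes u≡v = u≡v
eqB⇒≡ () | no _

module _ {G : Graph} where

  weaken : ∀ {P Q : Fin (n G) → Set} → (∀ {w} → P w → Q w) →
           ∀ {u v} → PathIn G P u v → PathIn G Q u v
  weaken f (here p)     = here (f p)
  weaken f (step p e r) = step (f p) e (weaken f r)

  _++ₚ_ : ∀ {P u v w} → PathIn G P u v → PathIn G P v w → PathIn G P u w
  here _     ++ₚ q = q
  step p e r ++ₚ q = step p e (r ++ₚ q)

  _⟨_⟩_ : ∀ {P u v w t} → PathIn G P u v → E G v w → PathIn G P w t → PathIn G P u t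
  r ⟨ e ⟩ q = r ++ₚ step (end r) e q
    where
    end : ∀ {P u v} → PathIn G P u v → P v
    end (here p)     = p
    end (step _ _ r) = end r

  reverse : Undirected G → ∀ {P u v} → PathIn G P u v → PathIn G P v u
  reverse sym-G (here p)     = here p
  reverse sym-G (step p e r) = reverse sym-G r ⟨ sym-G _ _ e ⟩ here p

  vertices : ∀ {P u v} → PathIn G P u v → List (Fin (n G))
  vertices (here {u} _)     = List.[ u ]
  vertices (step {u} _ _ r) = u List.∷ vertices r

  start∈vertices : ∀ {P u v} (r : PathIn G P u v) → u ∈ vertices r
  start∈vertices (here _)     = here refl
  start∈vertices (step _ _ _) = here refl

  ∈vertices⇒P : ∀ {P u v} (r : PathIn G P u v) → ∀ {w} → w ∈ vertices r → P w
  ∈vertices⇒P (here p)     (here refl) = p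
  ∈vertices⇒P (step p _ _) (here refl) = p
  ∈vertices⇒P (step _ _ r) (there w∈) = ∈vertices⇒P r w∈

  suffix : ∀ {P u v} (r : PathIn G P u v) → ∀ {w} → w ∈ vertices r →
           PathIn G (_∈ vertices r) w v
  suffix (here p)     (here refl) = here (here refl)
  suffix (step p e r) (here refl) = step (here refl) e (weaken there (suffix r (start∈vertices r)))
  suffix (step p e r) (there w∈)  = weaken there (suffix r w∈)

map-path : ∀ {H G : Graph} {P : Fin (n H) → Set} {Q : Fin (n G) → Set} (f : Fin (n H) → Fin (n G)) →
           Homomorphism H G f → (∀ {w} → P w → Q (f w)) →
           ∀ {u v} → PathIn H P u v → PathIn G Q (f u) (f v)
map-path f hom q (here p)     = here (q p)
map-path f hom q (step p e r) = step (q p) (hom _ _ e) (map-path f hom q r)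

module _ (G : Graph) (x y : Fin (n G)) where

  addEdge-⊇ : ∀ u v → E G u v → E (addEdge G x y) u v
  addEdge-⊇ u v e rewrite e = refl

  addEdge-xy : E (addEdge G x y) x y
  addEdge-xy rewrite eqB-refl x | eqB-refl y = ∨-zeroʳ (adj G x y)

  addEdge-yx : E (addEdge G x y) y x
  addEdge-yx rewrite eqB-refl x | eqB-refl y = trans (cong (adj G y x ∨_) (∨-zeroʳ _)) (∨-zeroʳ _)

  addEdge-cases : ∀ u v → E (addEdge G x y) u v → E G u v ⊎ (u ≡ x × v ≡ y) ⊎ (u ≡ y × v ≡ x)
  addEdge-cases u v e with ∨-true {adj G u v} e
  ... | inj₁ uv = inj₁ uv
  ... | inj₂ new with ∨-true {eqB u x ∧ eqB v y} new
  ... | inj₁ xy = let (ux , vy) = ∧-true xy in inj₂ (inj₁ (eqB⇒≡ ux , eqB⇒≡ vy))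
  ... | inj₂ yx = let (uy , vx) = ∧-true yx in inj₂ (inj₂ (eqB⇒≡ uy , eqB⇒≡ vx))

  addEdge-undirected : Undirected G → Undirected (addEdge G x y)
  addEdge-undirected sym-G u v e with addEdge-cases u v e
  ... | inj₁ uv                   = addEdge-⊇ v u (sym-G u v uv)
  ... | inj₂ (inj₁ (refl , refl)) = addEdge-yx
  ... | inj₂ (inj₂ (refl , refl)) = addEdge-xy

addEdge-comm : ∀ (G : Graph) x y u v → E (addEdge G y x) u v → E (addEdge G x y) u v
addEdge-comm G x y u v e with addEdge-cases G y x u v e
... | inj₁ uv                   = addEdge-⊇ G x y u v uv
... | inj₂ (inj₁ (refl , refl)) = addEdge-yx G x y
... | inj₂ (inj₂ (refl , refl)) = addEdge-xy G x y

addEdge-hom : ∀ {H G : Graph} (f : Fin (n H) → Fin (n G)) → Homomorphism H G f →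
              ∀ x y → Homomorphism (addEdge H x y) (addEdge G (f x) (f y)) f
addEdge-hom {H} {G} f hom x y u v e with addEdge-cases H x y u v e
... | inj₁ uv                   = addEdge-⊇ G _ _ _ _ (hom u v uv)
... | inj₂ (inj₁ (refl , refl)) = addEdge-xy G _ _
... | inj₂ (inj₂ (refl , refl)) = addEdge-yx G _ _

open MinorModel using (β; nonempty; connected)

minor-trans : ∀ {K H G} → MinorModel K H → MinorModel H G → MinorModel K G
minor-trans {K} {H} {G} M N = record
  { β         = β∘
  ; nonempty  = nonempty∘
  ; connected = connected∘
  ; edges     = edges∘
  }
  where
  β∘ : Fin (n G) → Maybe (Fin (n K))
  β∘ v = β N v >>= β M

  β∘-intro : ∀ {v p i} → β N v ≡ just p → β M p ≡ just i → β∘ v ≡ just i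
  β∘-intro {v} vp pi rewrite vp = pi

  β∘-elim : ∀ v {i} → β∘ v ≡ just i → ∃ λ p → β N v ≡ just p × β M p ≡ just i
  β∘-elim v vi with β N v
  ... | just p = p , refl , vi

  expand : ∀ {i p q} → PathIn H (λ w → β M w ≡ just i) p q →
           ∀ {u v} → β N u ≡ just p → β N v ≡ just q → PathIn G (λ w → β∘ w ≡ just i) u v
  expand (here {p} pi) {u} {v} up vp = weaken (λ wp → β∘-intro wp pi) (connected N p u v up vp)
  expand (step {p} {r} pi e rest) {u} up vp with MinorModel.edges N p r e
  ... | u′ , v′ , u′p , v′r , u′v′ =
    weaken (λ wp → β∘-intro wp pi) (connected N p u u′ up u′p) ⟨ u′v′ ⟩ expand rest v′r vp

  nonempty∘ : ∀ i → ∃ λ v → β∘ v ≡ just i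
  nonempty∘ i with nonempty M i
  ... | p , pi with nonempty N p
  ... | v , vp = v , β∘-intro vp pi

  connected∘ : ∀ i u v → β∘ u ≡ just i → β∘ v ≡ just i → PathIn G (λ w → β∘ w ≡ just i) u v
  connected∘ i u v ui vi with β∘-elim u ui | β∘-elim v vi
  ... | p , up , pi | q , vq , qi = expand (connected M i p q pi qi) up vq

  edges∘ : ∀ i j → E K i j → ∃₂ λ u v → β∘ u ≡ just i × β∘ v ≡ just j × E G u v
  edges∘ i j ij with MinorModel.edges M i j ij
  ... | p , q , pi , qj , pq with MinorModel.edges N p q pq
  ... | u , v , up , vq , uv = u , v , β∘-intro up pi , β∘-intro vq qj , uv

minor-⊆ : ∀ {K} (G : Graph) (a : Fin (n G) → Fin (n G) → Bool) →
          (∀ u v → adj G u v ≡ true → a u v ≡ true) →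
          MinorModel K G → MinorModel K (record { n = n G ; adj = a })
minor-⊆ G a G⊆a M = record
  { β         = β M
  ; nonempty  = nonempty M
  ; connected = λ i u v ui vi → map-path (λ w → w) G⊆a (λ p → p) (connected M i u v ui vi)
  ; edges     = λ i j ij → let (u , v , ui , vj , uv) = MinorModel.edges M i j ij in
                           u , v , ui , vj , G⊆a u v uv
  }

HasK9=Minor-trans : ∀ {H G} → MinorModel H G → HasK9=Minor H → HasK9=Minor G
HasK9=Minor-trans N (a , b , c , d , a≢b , c≢d , distinct , M) =
  a , b , c , d , a≢b , c≢d , distinct , minor-trans M N

HasK9=Minor-addEdge-comm : ∀ G x y → HasK9=Minor (addEdge G y x) → HasK9=Minor (addEdge G x y)
HasK9=Minor-addEdge-comm G x y (a , b , c , d , a≢b , c≢d , distinct , M) =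
  a , b , c , d , a≢b , c≢d , distinct , minor-⊆ (addEdge G y x) _ (addEdge-comm G x y) M

-- Branch sets {g p}, except that the branch set of c is {g c} together with the vertices in L.
module ExtendedEmbedding {H G : Graph} (g : Fin (n H) → Fin (n G)) (g-inj : Injective _≡_ _≡_ g)
                         (c : Fin (n H)) (L : List (Fin (n G)))
                         (L-fresh : ∀ {u} → u ∈ L → ∀ p → g p ≢ u) where

  open import Data.List.Membership.DecPropositional (_≟_ {n G}) using (_∈?_)

  Branch : Fin (n H) → Fin (n G) → Set
  Branch p u = u ≡ g p ⊎ (p ≡ c × u ∈ L)

  InBranchOfC : Fin (n G) → Set
  InBranchOfC w = w ∈ L ⊎ w ≡ g c

  β′ : Fin (n G) → Maybe (Fin (n H))
  β′ u with any? (λ p → g p ≟ u)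
  ... | yes (p , _) = just p
  ... | no _ with u ∈? L
  ...   | yes _ = just c
  ...   | no _  = nothing

  β′-intro : ∀ {p u} → Branch p u → β′ u ≡ just p
  β′-intro {p} {u} p∋u with any? (λ q → g q ≟ u)
  β′-intro (inj₁ refl)          | yes (q , gq≡gp) = cong just (g-inj gq≡gp)
  β′-intro (inj₂ (_ , u∈L))     | yes (q , gq≡u)  = ⊥-elim (L-fresh u∈L q gq≡u)
  β′-intro {p} (inj₁ refl)      | no ∄q           = ⊥-elim (∄q (p , refl))
  β′-intro {u = u} (inj₂ (refl , u∈L)) | no _ with u ∈? L
  ... | yes _   = refl
  ... | no u∉L = ⊥-elim (u∉L u∈L)

  β′-elim : ∀ {p u} → β′ u ≡ just p → Branch p u
  β′-elim {u = u} eq with any? (λ q → g q ≟ u)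
  β′-elim refl | yes (q , gq≡u) = inj₁ (sym gq≡u)
  β′-elim {u = u} eq | no _ with u ∈? L
  β′-elim refl | no _ | yes u∈L = inj₂ (refl , u∈L)

  minor : (∀ {u} → u ∈ L → PathIn G InBranchOfC u (g c)) →
          (∀ {u} → u ∈ L → PathIn G InBranchOfC (g c) u) →
          (∀ p q → E H p q → ∃₂ λ u v → Branch p u × Branch q v × E G u v) →
          MinorModel H G
  minor to-c from-c edges′ = record
    { β         = β′
    ; nonempty  = λ p → g p , β′-intro (inj₁ refl)
    ; connected = λ p u v up vp → connect (β′-elim up) (β′-elim vp)
    ; edges     = λ p q pq → let (u , v , up , vq , uv) = edges′ p q pq in
                             u , v , β′-intro up , β′-intro vq , uv
    }
    where
    inC : ∀ {w} → InBranchOfC w → β′ w ≡ just c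
    inC (inj₁ w∈L) = β′-intro (inj₂ (refl , w∈L))
    inC (inj₂ refl) = β′-intro (inj₁ refl)

    connect : ∀ {p u v} → Branch p u → Branch p v → PathIn G (λ w → β′ w ≡ just p) u v
    connect (inj₁ refl)          (inj₁ refl)          = here (β′-intro (inj₁ refl))
    connect (inj₁ refl)          (inj₂ (refl , v∈L)) = weaken inC (from-c v∈L)
    connect (inj₂ (refl , u∈L)) (inj₁ refl)          = weaken inC (to-c u∈L)
    connect (inj₂ (refl , u∈L)) (inj₂ (_ , v∈L))    = weaken inC (to-c u∈L ++ₚ from-c v∈L)

addEdge-embedding-minor : ∀ {H G} (f : Fin (n H) → Fin (n G)) → Injective _≡_ _≡_ f → Homomorphism H G f →
                          ∀ x y → MinorModel (addEdge H x y) (addEdge G (f x) (f y))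
addEdge-embedding-minor {H} {G} f f-inj hom x y =
  ExtendedEmbedding.minor {G = addEdge G (f x) (f y)} f f-inj x List.[] (λ ()) (λ ()) (λ ()) λ p q pq →
    f p , f q , inj₁ refl , inj₁ refl , addEdge-hom {G = G} f hom x y p q pq

∷-injective : ∀ {A : Set} {m} {f : Vector A m} {a : A} →
              Injective _≡_ _≡_ f → (∀ i → f i ≢ a) → Injective _≡_ _≡_ (a ∷ f)
∷-injective f-inj a∉f {zero}  {zero}  _  = refl
∷-injective f-inj a∉f {zero}  {suc j} eq = ⊥-elim (a∉f j (sym eq))
∷-injective f-inj a∉f {suc i} {zero}  eq = ⊥-elim (a∉f i eq)
∷-injective f-inj a∉f {suc i} {suc j} eq = cong suc (f-inj eq)

∷-clique : ∀ {G : Graph} {m} {f : Vector (Fin (n G)) m} {a} →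
           Undirected G → Clique G f → (∀ i → E G a (f i)) → Clique G (a ∷ f)
∷-clique sym-G f-clique a~f zero    zero    0≢0 = ⊥-elim (0≢0 refl)
∷-clique sym-G f-clique a~f zero    (suc j) _   = a~f j
∷-clique sym-G f-clique a~f (suc i) zero    _   = sym-G _ _ (a~f i)
∷-clique sym-G f-clique a~f (suc i) (suc j) i≢j = f-clique i j (λ i≡j → i≢j (cong suc i≡j))

outside-image : ∀ {m k N} → m ℕ.< k → (h : Vector (Fin N) m) (e : Vector (Fin N) k) →
                Injective _≡_ _≡_ e → ∃ λ l → ∀ j → h j ≢ e l
outside-image {m} {k} m<k h e e-inj with all? (λ l → any? (λ j → h j ≟ e l))
... | yes covered = ⊥-elim (<⇒notInjective m<k φ-injective)
  where
  φ : Fin k → Fin m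
  φ l = proj₁ (covered l)

  φ-injective : Injective _≡_ _≡_ φ
  φ-injective {i} {j} φi≡φj = e-inj (trans (sym (proj₂ (covered i))) (trans (cong h φi≡φj) (proj₂ (covered j))))
... | no ¬covered =
  let (l , l∉) = ¬∀⟶∃¬ k _ (λ l → any? (λ j → h j ≟ e l)) ¬covered in l , λ j eq → l∉ (j , eq)

module _ (m : ℕ) (col : Fin m → ℕ) where

  multipartite-undirected : Undirected (multipartite m col)
  multipartite-undirected u v e with col u ℕ.≟ col v | col v ℕ.≟ col u
  multipartite-undirected u v () | yes _ | _
  ... | no _     | no _      = refl
  ... | no cu≢cv | yes cv≡cu = ⊥-elim (cu≢cv (sym cv≡cu))

  multipartite-adj : ∀ u v → col u ≢ col v → E (multipartite m col) u v
  multipartite-adj u v cu≢cv with col u ℕ.≟ col v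
  ... | yes cu≡cv = ⊥-elim (cu≢cv cu≡cv)
  ... | no _      = refl

  multipartite-adj⁻ : ∀ u v → E (multipartite m col) u v → col u ≢ col v
  multipartite-adj⁻ u v e with col u ℕ.≟ col v
  multipartite-adj⁻ u v () | yes _
  ... | no cu≢cv = cu≢cv

module _ {G H : Graph} (I : Iso G H) where
  open Iso I

  Iso-hom : Homomorphism G H to
  Iso-hom u v e = trans (sym (pres u v)) e

  Iso-hom⁻ : ∀ {u v} → E H (to u) (to v) → E G u v
  Iso-hom⁻ {u} {v} e = trans (pres u v) e

  Iso-from-hom : Homomorphism H G from
  Iso-from-hom a b e = Iso-hom⁻ (subst₂ (E H) (sym (to-from a)) (sym (to-from b)) e)

  Iso-to-injective : Injective _≡_ _≡_ to
  Iso-to-injective {u} {v} eq = trans (sym (from-to u)) (trans (cong from eq) (from-to v))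

  Iso-from-injective : Injective _≡_ _≡_ from
  Iso-from-injective {a} {b} eq = trans (sym (to-from a)) (trans (cong to eq) (to-from b))

  Iso-undirected : Undirected H → Undirected G
  Iso-undirected sym-H u v e = Iso-hom⁻ (sym-H _ _ (Iso-hom u v e))

K8-adj : ∀ {G} (I : Iso G K8) {u v} → u ≢ v → E G u v
K8-adj I u≢v = Iso-hom⁻ I (multipartite-adj 8 toℕ _ _ (λ eq → u≢v (Iso-to-injective I (toℕ-injective eq))))

part : Fin 10 → Fin 5
part = # 0 ∷ # 0 ∷ # 1 ∷ # 1 ∷ # 2 ∷ # 2 ∷ # 3 ∷ # 3 ∷ # 4 ∷ # 4 ∷ []

partner : Fin 10 → Fin 10
partner = # 1 ∷ # 0 ∷ # 3 ∷ # 2 ∷ # 5 ∷ # 4 ∷ # 7 ∷ # 6 ∷ # 9 ∷ # 8 ∷ []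

toℕ-part : ∀ u → toℕ (part u) ≡ toℕ u / 2
toℕ-part = from-yes (all? λ u → toℕ (part u) ℕ.≟ toℕ u / 2)

partner-spec : ∀ u → partner u ≢ u × part (partner u) ≡ part u
partner-spec = from-yes (all? λ u → ¬? (partner u ≟ u) ×-dec part (partner u) ≟ part u)

K22222-adj : ∀ a b → part a ≢ part b → E K22222 a b
K22222-adj a b pa≢pb = multipartite-adj 10 _ a b λ eq →
  pa≢pb (toℕ-injective (trans (toℕ-part a) (trans eq (sym (toℕ-part b)))))

K22222-adj⁻ : ∀ a b → E K22222 a b → part a ≢ part b
K22222-adj⁻ a b e pa≡pb = multipartite-adj⁻ 10 _ a b e
  (trans (sym (toℕ-part a)) (trans (cong toℕ pa≡pb) (toℕ-part b)))

CliqueSum-flip : ∀ {k G₁ G₂ G} → CliqueSum k G₁ G₂ G → CliqueSum k G₂ G₁ G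
CliqueSum-flip cs = record
  { c₁ = c₂ ; c₂ = c₁ ; c₁-inj = c₂-inj ; c₂-inj = c₁-inj ; c₁-clique = c₂-clique ; c₂-clique = c₁-clique
  ; f₁ = f₂ ; f₂ = f₁ ; f₁-inj = f₂-inj ; f₂-inj = f₁-inj
  ; glued = λ i → sym (glued i)
  ; meet  = λ a b eq → let (i , b≡ , a≡) = meet b a (sym eq) in i , a≡ , b≡
  ; cover = λ v → swap (cover v)
  ; edges = λ u v → record
      { to        = λ e → swap (Equivalence.to (edges u v) e)
      ; from      = λ e → Equivalence.from (edges u v) (swap e)
      ; to-cong   = λ { refl → refl }
      ; from-cong = λ { refl → refl }
      }
  }
  where
  open CliqueSum cs
  swap : ∀ {A B : Set} → A ⊎ B → B ⊎ A
  swap (inj₁ a) = inj₂ a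
  swap (inj₂ b) = inj₁ b

module _ {k} {G₁ G₂ G : Graph} (cs : CliqueSum k G₁ G₂ G) where
  open CliqueSum cs

  f₁-hom : Homomorphism G₁ G f₁
  f₁-hom a b e = Equivalence.from (edges (f₁ a) (f₁ b)) (inj₁ (a , b , refl , refl , e))

  f₂-hom : Homomorphism G₂ G f₂
  f₂-hom a b e = Equivalence.from (edges (f₂ a) (f₂ b)) (inj₂ (a , b , refl , refl , e))

  -- An edge of G between vertices of G₁ comes from G₁, or from G₂ inside the glued clique.
  f₁-hom⁻ : ∀ {p q} → p ≢ q → E G (f₁ p) (f₁ q) → E G₁ p q
  f₁-hom⁻ {p} {q} p≢q e with Equivalence.to (edges (f₁ p) (f₁ q)) e
  ... | inj₁ (a , b , fa≡fp , fb≡fq , ab) with f₁-inj fa≡fp | f₁-inj fb≡fq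
  ...   | refl | refl = ab
  f₁-hom⁻ {p} {q} p≢q e | inj₂ (a , b , fa≡fp , fb≡fq , _) with meet p a (sym fa≡fp) | meet q b (sym fb≡fq)
  ...   | i , refl , _ | j , refl , _ = c₁-clique i j (λ i≡j → p≢q (cong c₁ i≡j))

  Lift : ∀ {m} → Vector (Fin (n G)) m → Set
  Lift {m} h = Σ (Vector (Fin (n G₁)) m) λ h₁ → ∀ l → f₁ (h₁ l) ≡ h l

  lift-injective : ∀ {m} {h : Vector (Fin (n G)) m} → Injective _≡_ _≡_ h → (h↑ : Lift h) →
                   Injective _≡_ _≡_ (proj₁ h↑)
  lift-injective h-inj (h₁ , f₁h₁≡h) {i} {j} eq = h-inj (trans (sym (f₁h₁≡h i)) (trans (cong f₁ eq) (f₁h₁≡h j)))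

  lift-clique : ∀ {m} {h : Vector (Fin (n G)) m} → Injective _≡_ _≡_ h → Clique G h → (h↑ : Lift h) →
                Clique G₁ (proj₁ h↑)
  lift-clique h-inj h-clique (h₁ , f₁h₁≡h) i j i≢j =
    f₁-hom⁻ (λ eq → i≢j (lift-injective h-inj (h₁ , f₁h₁≡h) eq))
            (subst₂ (E G) (sym (f₁h₁≡h i)) (sym (f₁h₁≡h j)) (h-clique i j i≢j))

-- A vertex of the clique outside the image of G₁ is adjacent to all the others, so they all lie in G₂.
clique-side : ∀ {k G₁ G₂ G} (cs : CliqueSum k G₁ G₂ G) {m} (h : Vector (Fin (n G)) m) →
              Clique G h → Lift cs h ⊎ Lift (CliqueSum-flip cs) h
clique-side cs {m} h h-clique with all? (λ l → any? (λ a → CliqueSum.f₁ cs a ≟ h l))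
... | yes in-G₁ = inj₁ ((λ l → proj₁ (in-G₁ l)) , (λ l → proj₂ (in-G₁ l)))
... | no ¬in-G₁ = inj₂ ((λ l → proj₁ (in-G₂ l)) , (λ l → proj₂ (in-G₂ l)))
  where
  open CliqueSum cs
  outside : ∃ λ l₀ → ¬ ∃ λ a → f₁ a ≡ h l₀
  outside = ¬∀⟶∃¬ m _ (λ l → any? (λ a → f₁ a ≟ h l)) ¬in-G₁

  in-G₂ : ∀ l → ∃ λ b → f₂ b ≡ h l
  in-G₂ l with cover (h l) | outside
  ... | inj₂ in₂      | _ = in₂
  ... | inj₁ (a , fa≡hl) | l₀ , l₀∉ with l ≟ l₀
  ...   | yes refl = ⊥-elim (l₀∉ (a , fa≡hl))
  ...   | no l≢l₀ with Equivalence.to (edges (h l₀) (h l)) (h-clique l₀ l (λ eq → l≢l₀ (sym eq)))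
  ...     | inj₁ (a′ , _ , fa′≡hl₀ , _ , _) = ⊥-elim (l₀∉ (a′ , fa′≡hl₀))
  ...     | inj₂ (_ , b′ , _ , fb′≡hl , _)  = b′ , fb′≡hl

Cockade-undirected : ∀ {G} → Cockade K8 K22222 5 G → Undirected G
Cockade-undirected (base₁ I) = Iso-undirected I (multipartite-undirected 8 toℕ)
Cockade-undirected (base₂ I) = Iso-undirected I (multipartite-undirected 10 _)
Cockade-undirected (glue C₁ C₂ cs) u v e with Equivalence.to (CliqueSum.edges cs u v) e
... | inj₁ (a , b , refl , refl , ab) = f₁-hom cs b a (Cockade-undirected C₁ a b ab)
... | inj₂ (a , b , refl , refl , ab) = f₂-hom cs b a (Cockade-undirected C₂ a b ab)

-- Cliques of size six extend to K8

record ExtendingEdge (G : Graph) {m} (h : Vector (Fin (n G)) m) : Set where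
  field
    u v : Fin (n G)
    h∌u : ∀ l → h l ≢ u
    h∌v : ∀ l → h l ≢ v
    u≢v : u ≢ v
    h~u : ∀ l → E G (h l) u
    h~v : ∀ l → E G (h l) v
    u~v : E G u v

K8-extendingEdge : ∀ {G} → Iso G K8 → (h : Vector (Fin (n G)) 6) → ExtendingEdge G h
K8-extendingEdge I h with outside-image (from-yes (6 ℕ.<? 8)) h (Iso.from I) (Iso-from-injective I)
... | l , h∌u with outside-image (from-yes (7 ℕ.<? 8)) (Iso.from I l ∷ h) (Iso.from I) (Iso-from-injective I)
... | l′ , uh∌v = record
  { u   = Iso.from I l
  ; v   = Iso.from I l′
  ; h∌u = h∌u
  ; h∌v = λ j → uh∌v (suc j)
  ; u≢v = uh∌v zero
  ; h~u = λ j → K8-adj I (h∌u j)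
  ; h~v = λ j → K8-adj I (uh∌v (suc j))
  ; u~v = K8-adj I (uh∌v zero)
  }

K22222-no-6-clique : ∀ {G} → Iso G K22222 → (h : Vector (Fin (n G)) 6) → ¬ Clique G h
K22222-no-6-clique I h h-clique with pigeonhole (from-yes (5 ℕ.<? 6)) (λ l → part (Iso.to I (h l)))
... | i , j , i<j , same-part =
  K22222-adj⁻ (Iso.to I (h i)) (Iso.to I (h j)) (Iso-hom I _ _ (h-clique i j (<⇒≢ i<j))) same-part

ExtendingEdge-push : ∀ {k G₁ G₂ G} (cs : CliqueSum k G₁ G₂ G) {m} {h : Vector (Fin (n G)) m} →
                     (h↑ : Lift cs h) → ExtendingEdge G₁ (proj₁ h↑) → ExtendingEdge G h
ExtendingEdge-push {G = G} cs (h₁ , f₁h₁≡h) X = record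
  { u   = f₁ u
  ; v   = f₁ v
  ; h∌u = λ l eq → h∌u l (f₁-inj (trans (f₁h₁≡h l) eq))
  ; h∌v = λ l eq → h∌v l (f₁-inj (trans (f₁h₁≡h l) eq))
  ; u≢v = λ eq → u≢v (f₁-inj eq)
  ; h~u = λ l → subst (λ w → E G w (f₁ u)) (f₁h₁≡h l) (f₁-hom cs _ _ (h~u l))
  ; h~v = λ l → subst (λ w → E G w (f₁ v)) (f₁h₁≡h l) (f₁-hom cs _ _ (h~v l))
  ; u~v = f₁-hom cs _ _ u~v
  }
  where
  open CliqueSum cs
  open ExtendingEdge X

extendingEdge : ∀ {G} → Cockade K8 K22222 5 G → (h : Vector (Fin (n G)) 6) →
                Injective _≡_ _≡_ h → Clique G h → ExtendingEdge G h
extendingEdge (base₁ I) h h-inj h-clique = K8-extendingEdge I h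
extendingEdge (base₂ I) h h-inj h-clique = ⊥-elim (K22222-no-6-clique I h h-clique)
extendingEdge (glue C₁ C₂ cs) h h-inj h-clique with clique-side cs h h-clique
... | inj₁ h↑ = ExtendingEdge-push cs h↑
                  (extendingEdge C₁ _ (lift-injective cs h-inj h↑) (lift-clique cs h-inj h-clique h↑))
... | inj₂ h↑ = ExtendingEdge-push (CliqueSum-flip cs) h↑
                  (extendingEdge C₂ _ (lift-injective (CliqueSum-flip cs) h-inj h↑)
                                      (lift-clique (CliqueSum-flip cs) h-inj h-clique h↑))

-- Reaching a neighbour of a clique vertex around the clique

Avoids : ∀ {N m} → Vector (Fin N) m → Fin N → Set
Avoids c v = ∀ j → c j ≢ v

NeighbourReachable : (G : Graph) → Vector (Fin (n G)) 5 → Fin (n G) → Fin 5 → Set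
NeighbourReachable G c y i = ∃ λ w → PathIn G (Avoids c) y w × E G w (c i)

NeighboursReachable : Graph → Set
NeighboursReachable G = (c : Vector (Fin (n G)) 5) → Injective _≡_ _≡_ c → Clique G c →
                        ∀ y → Avoids c y → ∀ i → NeighbourReachable G c y i

K8-neighboursReachable : ∀ {G} → Iso G K8 → NeighboursReachable G
K8-neighboursReachable I c _ _ y c∌y i = y , here c∌y , K8-adj I (λ eq → c∌y i (sym eq))

-- If y is not adjacent to c i it lies in the part of c i; the partner of any other clique vertex
-- is then adjacent to both and avoids the clique.
K22222-neighboursReachable : ∀ {G} → Iso G K22222 → NeighboursReachable G
K22222-neighboursReachable {G} I c c-inj c-clique y c∌y i with adj G y (c i) in y~ci
... | true  = y , here c∌y , y~ci
... | false = w , step c∌y y~w (here c∌w) , w~ci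
  where
  open Iso I
  j : Fin 5
  j = Fin.punchIn i zero

  j≢i : j ≢ i
  j≢i = punchInᵢ≢i i zero

  w : Fin (n G)
  w = from (partner (to (c j)))

  part-w : part (to w) ≡ part (to (c j))
  part-w = trans (cong part (to-from _)) (proj₂ (partner-spec (to (c j))))

  part-ci≢part-cj : part (to (c i)) ≢ part (to (c j))
  part-ci≢part-cj = K22222-adj⁻ (to (c i)) (to (c j)) (Iso-hom I _ _ (c-clique i j (λ eq → j≢i (sym eq))))

  part-y : part (to y) ≡ part (to (c i))
  part-y with part (to y) ≟ part (to (c i))
  ... | yes same = same
  ... | no differ with () ← trans (sym y~ci) (Iso-hom⁻ I (K22222-adj (to y) (to (c i)) differ))

  c∌w : Avoids c w
  c∌w m cm≡w with m ≟ j
  ... | yes refl = proj₁ (partner-spec (to (c j))) (sym (trans (cong to cm≡w) (to-from _)))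
  ... | no m≢j   = K22222-adj⁻ (to (c m)) (to (c j)) (Iso-hom I _ _ (c-clique m j m≢j))
                               (trans (cong (part ∘ to) cm≡w) part-w)

  y~w : E G y w
  y~w = Iso-hom⁻ I (K22222-adj (to y) (to w) λ eq → part-ci≢part-cj (trans (sym part-y) (trans eq part-w)))

  w~ci : E G w (c i)
  w~ci = Iso-hom⁻ I (K22222-adj (to w) (to (c i)) λ eq → part-ci≢part-cj (trans (sym eq) part-w))

module _ {G₁ G₂ G : Graph} (cs : CliqueSum 5 G₁ G₂ G)
         (reach₁ : NeighboursReachable G₁) (reach₂ : NeighboursReachable G₂)
         {c : Vector (Fin (n G)) 5} (c-inj : Injective _≡_ _≡_ c) (c-clique : Clique G c)
         (c↑ : Lift cs c) where
  open CliqueSum cs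

  private
    c′ : Vector (Fin (n G₁)) 5
    c′ = proj₁ c↑

    f₁c′≡c : ∀ j → f₁ (c′ j) ≡ c j
    f₁c′≡c = proj₂ c↑

    reach′ : ∀ y → Avoids c′ y → ∀ i → NeighbourReachable G₁ c′ y i
    reach′ = reach₁ c′ (lift-injective cs c-inj c↑) (lift-clique cs c-inj c-clique c↑)

    path₁ : ∀ {u v} → PathIn G₁ (Avoids c′) u v → PathIn G (Avoids c) (f₁ u) (f₁ v)
    path₁ = map-path f₁ (f₁-hom cs) λ c′∌v j eq → c′∌v j (f₁-inj (trans (f₁c′≡c j) eq))

    path₂ : ∀ {u v} → PathIn G₂ (Avoids c₂) u v → PathIn G (Avoids c) (f₂ u) (f₂ v)
    path₂ = map-path f₂ (f₂-hom cs) avoid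
      where
      avoid : ∀ {v} → Avoids c₂ v → Avoids c (f₂ v)
      avoid c₂∌v j eq with meet (c′ j) _ (trans (f₁c′≡c j) eq)
      ... | l , _ , v≡c₂l = c₂∌v l (sym v≡c₂l)

    -- Unless c′ i is a glued vertex, the five glued vertices and c′ i are six vertices of G₁,
    -- so some glued vertex c₁ l is not in c′: the path crosses from G₂ to G₁ there.
    through-G₂ : ∀ y → Avoids c₂ y → ∀ i → NeighbourReachable G c (f₂ y) i
    through-G₂ y c₂∌y i with any? (λ l → c₁ l ≟ c′ i)
    ... | yes (l , c₁l≡c′i) =
      let (w , p , w~c₂l) = reach₂ c₂ c₂-inj c₂-clique y c₂∌y l in
      f₂ w , path₂ p , subst (E G (f₂ w)) (trans (sym (glued l)) (trans (cong f₁ c₁l≡c′i) (f₁c′≡c i)))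
                             (f₂-hom cs _ _ w~c₂l)
    ... | no c′i∉c₁ with outside-image (from-yes (5 ℕ.<? 6)) c′ (c′ i ∷ c₁)
                                       (∷-injective c₁-inj λ l eq → c′i∉c₁ (l , eq))
    ...   | zero  , c′∌c′i = ⊥-elim (c′∌c′i i refl)
    ...   | suc l , c′∌c₁l =
      let (w₂ , p₂ , w₂~c₂l) = reach₂ c₂ c₂-inj c₂-clique y c₂∌y l
          (w₁ , p₁ , w₁~c′i) = reach′ (c₁ l) c′∌c₁l i in
      f₁ w₁ , path₂ p₂ ⟨ subst (E G (f₂ w₂)) (sym (glued l)) (f₂-hom cs _ _ w₂~c₂l) ⟩ path₁ p₁ ,
      subst (E G (f₁ w₁)) (f₁c′≡c i) (f₁-hom cs _ _ w₁~c′i)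

  reach-lifted : ∀ y → Avoids c y → ∀ i → NeighbourReachable G c y i
  reach-lifted y c∌y i with any? (λ a → f₁ a ≟ y)
  ... | yes (y₁ , refl) =
    let (w , p , w~c′i) = reach′ y₁ (λ j eq → c∌y j (trans (sym (f₁c′≡c j)) (cong f₁ eq))) i in
    f₁ w , path₁ p , subst (E G (f₁ w)) (f₁c′≡c i) (f₁-hom cs _ _ w~c′i)
  ... | no y∉G₁ with cover y
  ...   | inj₁ y∈G₁         = ⊥-elim (y∉G₁ y∈G₁)
  ...   | inj₂ (y₂ , refl) = through-G₂ y₂ (λ l eq → y∉G₁ (c₁ l , trans (glued l) (cong f₂ eq))) i

neighboursReachable : ∀ {G} → Cockade K8 K22222 5 G → NeighboursReachable G
neighboursReachable (base₁ I) = K8-neighboursReachable I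
neighboursReachable (base₂ I) = K22222-neighboursReachable I
neighboursReachable (glue C₁ C₂ cs) c c-inj c-clique with clique-side cs c c-clique
... | inj₁ c↑ = reach-lifted cs (neighboursReachable C₁) (neighboursReachable C₂) c-inj c-clique c↑
... | inj₂ c↑ =
  reach-lifted (CliqueSum-flip cs) (neighboursReachable C₂) (neighboursReachable C₁) c-inj c-clique c↑

-- Minors whose branch sets are cliques, checked by computation

CliqueModel : (H G : Graph) → (Fin (n G) → Maybe (Fin (n H))) → Set
CliqueModel H G β′ =
  (∀ i → ∃ λ v → β′ v ≡ just i) ×
  (∀ i u v → β′ u ≡ just i → β′ v ≡ just i → u ≡ v ⊎ E G u v) ×
  (∀ i j → E H i j → ∃₂ λ u v → β′ u ≡ just i × β′ v ≡ just j × E G u v)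

cliqueModel? : ∀ H G β′ → Dec (CliqueModel H G β′)
cliqueModel? H G β′ =
  all? (λ i → any? λ v → β′ v ≟ᴹ just i) ×-dec
  all? (λ i → all? λ u → all? λ v → β′ u ≟ᴹ just i →-dec β′ v ≟ᴹ just i →-dec
                                     (u ≟ v ⊎-dec adj G u v Bool.≟ true)) ×-dec
  all? (λ i → all? λ j → adj H i j Bool.≟ true →-dec
         any? λ u → any? λ v → β′ u ≟ᴹ just i ×-dec β′ v ≟ᴹ just j ×-dec adj G u v Bool.≟ true)
  where
  _≟ᴹ_ = ≡-dec _≟_

CliqueModel⇒MinorModel : ∀ {H G β′} → CliqueModel H G β′ → MinorModel H G
CliqueModel⇒MinorModel {β′ = β′} (nonempty′ , clique , edges′) = record
  { β         = β′
  ; nonempty  = nonempty′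
  ; connected = λ i u v ui vi → path (clique i u v ui vi) ui vi
  ; edges     = edges′
  }
  where
  path : ∀ {G P u v} → u ≡ v ⊎ E G u v → P u → P v → PathIn G P u v
  path (inj₁ refl) pu _  = here pu
  path (inj₂ uv)   pu pv = step pu uv (here pv)

K9-56-78 : Graph
K9-56-78 = K9minus (# 5) (# 6) (# 7) (# 8)

K9-56-78⇒K9= : ∀ {G} → MinorModel K9-56-78 G → HasK9=Minor G
K9-56-78⇒K9= M = # 5 , # 6 , # 7 , # 8 , (λ ()) , (λ ()) , refl , M

K9-01-02 : Graph
K9-01-02 = K9minus (# 0) (# 1) (# 0) (# 2)

K9-01-02⇒K9= : ∀ {G} → MinorModel K9-01-02 G → HasK9=Minor G
K9-01-02⇒K9= M = # 0 , # 1 , # 0 , # 2 , (λ ()) , (λ ()) , refl , M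

K9-01-02-undirected : Undirected K9-01-02
K9-01-02-undirected = from-yes (all? λ p → all? λ q →
  adj K9-01-02 p q Bool.≟ true →-dec adj K9-01-02 q p Bool.≟ true)

K9-01-02-irreflexive : ∀ p q → E K9-01-02 p q → p ≢ q
K9-01-02-irreflexive = from-yes (all? λ p → all? λ q → adj K9-01-02 p q Bool.≟ true →-dec ¬? (p ≟ q))

-- Parts are numbered relative to the part of x, which also contains y. Every vertex is its own
-- branch set, except that the even vertices of parts 1 and 2 share one; part 0 is joined by the
-- new edge xy, so only the pairs of parts 3 and 4 stay nonadjacent.
K22222-branch : Fin 10 → Fin 10 → Maybe (Fin 9)
K22222-branch x v = just (label ((toℕ v / 2 + 5 ∸ toℕ x / 2) mod 5) (toℕ v mod 2))
  where
  label : Fin 5 → Fin 2 → Fin 9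
  label = (# 0 ∷ # 1 ∷ []) ∷ (# 2 ∷ # 3 ∷ []) ∷ (# 2 ∷ # 4 ∷ []) ∷ (# 5 ∷ # 6 ∷ []) ∷ (# 7 ∷ # 8 ∷ []) ∷ []

K22222+xy-cliqueModel : ∀ x y → x ≢ y → adj K22222 x y ≡ false →
                        CliqueModel K9-56-78 (addEdge K22222 x y) (K22222-branch x)
K22222+xy-cliqueModel = from-yes (all? λ x → all? λ y →
  ¬? (x ≟ y) →-dec adj K22222 x y Bool.≟ false →-dec
  cliqueModel? K9-56-78 (addEdge K22222 x y) (K22222-branch x))

NonEdgesForceK9= : Graph → Set
NonEdgesForceK9= G = ∀ x y → x ≢ y → adj G x y ≡ false → HasK9=Minor (addEdge G x y)

K8-nonEdgesForceK9= : ∀ {G} → Iso G K8 → NonEdgesForceK9= G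
K8-nonEdgesForceK9= I x y x≢y x≁y with () ← trans (sym x≁y) (K8-adj I x≢y)

K22222-nonEdgesForceK9= : ∀ {G} → Iso G K22222 → NonEdgesForceK9= G
K22222-nonEdgesForceK9= {G} I x y x≢y x≁y = K9-56-78⇒K9= (minor-trans model embedding)
  where
  open Iso I

  model : MinorModel K9-56-78 (addEdge K22222 (to x) (to y))
  model = CliqueModel⇒MinorModel (K22222+xy-cliqueModel (to x) (to y) (x≢y ∘ Iso-to-injective I)
                                                         (trans (sym (pres x y)) x≁y))

  embedding : MinorModel (addEdge K22222 (to x) (to y)) (addEdge G x y)
  embedding = subst₂ (λ x′ y′ → MinorModel _ (addEdge G x′ y′)) (from-to x) (from-to y)
                     (addEdge-embedding-minor {G = G} from (Iso-from-injective I) (Iso-from-hom I) (to x) (to y))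

nonNeighbour⊎dominates : ∀ (G : Graph) v {m} (h : Vector (Fin (n G)) m) →
                          (∃ λ i → adj G v (h i) ≡ false) ⊎ (∀ i → E G v (h i))
nonNeighbour⊎dominates G v h with any? (λ i → adj G v (h i) Bool.≟ false)
... | yes nonNeighbour = inj₁ nonNeighbour
... | no ∄nonNeighbour = inj₂ λ i → ¬-not (λ v≁hi → ∄nonNeighbour (i , v≁hi))

module _ {G₁ G₂ G : Graph} (cs : CliqueSum 5 G₁ G₂ G) where
  open CliqueSum cs

  nonEdge-within : NonEdgesForceK9= G₁ → ∀ {a b x y} → f₁ a ≡ x → f₁ b ≡ y →
                   x ≢ y → adj G x y ≡ false → HasK9=Minor (addEdge G x y)
  nonEdge-within ih {a} {b} refl refl x≢y x≁y with adj G₁ a b in a~b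
  ... | true with () ← trans (sym x≁y) (f₁-hom cs a b a~b)
  ... | false = HasK9=Minor-trans (addEdge-embedding-minor {G = G} f₁ f₁-inj (f₁-hom cs) a b)
                                  (ih a b (x≢y ∘ cong f₁) a~b)

  -- Contracting a path from y to a neighbour of c i, which runs in G₂ around the clique, into the
  -- branch set of c i turns the new edge xy into the edge a (c₁ i).
  reroute-minor : NeighboursReachable G₂ → Undirected G → ∀ a {b} → Avoids c₂ b → ∀ i →
                  MinorModel (addEdge G₁ a (c₁ i)) (addEdge G (f₁ a) (f₂ b))
  reroute-minor reach₂ sym-G a {b} c₂∌b i =
    minor to-c (reverse (addEdge-undirected G _ _ sym-G) ∘ to-c) edges′
    where
    G′ = addEdge G (f₁ a) (f₂ b)

    walk : NeighbourReachable G₂ c₂ b i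
    walk = reach₂ c₂ c₂-inj c₂-clique b c₂∌b i

    w : Fin (n G₂)
    w = proj₁ walk

    route : PathIn G₂ (Avoids c₂) b w
    route = proj₁ (proj₂ walk)

    L : List (Fin (n G))
    L = List.map f₂ (vertices route)

    L-fresh : ∀ {u} → u ∈ L → ∀ p → f₁ p ≢ u
    L-fresh u∈L p f₁p≡u with ∈-map⁻ f₂ u∈L
    ... | v , v∈ , refl with meet p v f₁p≡u
    ...   | l , _ , v≡c₂l = ∈vertices⇒P route v∈ l (sym v≡c₂l)

    open ExtendedEmbedding {addEdge G₁ a (c₁ i)} {G′} f₁ f₁-inj (c₁ i) L L-fresh

    f₂-hom′ : Homomorphism G₂ G′ f₂
    f₂-hom′ u v e = addEdge-⊇ G _ _ _ _ (f₂-hom cs u v e)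

    to-c : ∀ {u} → u ∈ L → PathIn G′ InBranchOfC u (f₁ (c₁ i))
    to-c u∈L with ∈-map⁻ f₂ u∈L
    ... | v , v∈ , refl =
      map-path f₂ f₂-hom′ (inj₁ ∘ ∈-map⁺ f₂) (suffix route v∈)
        ⟨ subst (E G′ (f₂ w)) (sym (glued i)) (f₂-hom′ w (c₂ i) (proj₂ (proj₂ walk))) ⟩
      here (inj₂ refl)

    b∈L : f₂ b ∈ L
    b∈L = ∈-map⁺ f₂ (start∈vertices route)

    edges′ : ∀ p q → E (addEdge G₁ a (c₁ i)) p q → ∃₂ λ u v → Branch p u × Branch q v × E G′ u v
    edges′ p q e with addEdge-cases G₁ a (c₁ i) p q e
    ... | inj₁ pq                   = f₁ p , f₁ q , inj₁ refl , inj₁ refl , addEdge-⊇ G _ _ _ _ (f₁-hom cs p q pq)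
    ... | inj₂ (inj₁ (refl , refl)) = f₁ a , f₂ b , inj₁ refl , inj₂ (refl , b∈L) , addEdge-xy G _ _
    ... | inj₂ (inj₂ (refl , refl)) = f₂ b , f₁ a , inj₂ (refl , b∈L) , inj₁ refl , addEdge-yx G _ _

  -- A K8 of G₁ on v₁, u₁, a and the glued clique, plus a vertex u₂ of G₂ seeing b and the glued
  -- clique; y joins the branch set of a, so only u₂v₁ and u₂u₁ are missing.
  dominating-K9= : Cockade K8 K22222 5 G₁ → Cockade K8 K22222 5 G₂ →
                   ∀ {a b} → Avoids c₁ a → Avoids c₂ b → (∀ i → E G₁ a (c₁ i)) → (∀ i → E G₂ b (c₂ i)) →
                   HasK9=Minor (addEdge G (f₁ a) (f₂ b))
  dominating-K9= C₁ C₂ {a} {b} c₁∌a c₂∌b a~c₁ b~c₂ =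
    K9-01-02⇒K9= (minor to-c (reverse (addEdge-undirected G _ _ sym-G) ∘ to-c) edges′)
    where
    G′ = addEdge G (f₁ a) (f₂ b)
    sym-G = Cockade-undirected (glue C₁ C₂ cs)
    sym₁ = Cockade-undirected C₁
    sym₂ = Cockade-undirected C₂

    module X₁ = ExtendingEdge (extendingEdge C₁ (a ∷ c₁) (∷-injective c₁-inj c₁∌a) (∷-clique sym₁ c₁-clique a~c₁))
    module X₂ = ExtendingEdge (extendingEdge C₂ (b ∷ c₂) (∷-injective c₂-inj c₂∌b) (∷-clique sym₂ c₂-clique b~c₂))

    K : Vector (Fin (n G₁)) 8
    K = X₁.v ∷ X₁.u ∷ a ∷ c₁

    K-injective : Injective _≡_ _≡_ K
    K-injective = ∷-injective (∷-injective (∷-injective c₁-inj c₁∌a) X₁.h∌u) v∉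
      where
      v∉ : ∀ j → (X₁.u ∷ a ∷ c₁) j ≢ X₁.v
      v∉ zero    = X₁.u≢v
      v∉ (suc j) = X₁.h∌v j

    K-clique : Clique G₁ K
    K-clique = ∷-clique sym₁ (∷-clique sym₁ (∷-clique sym₁ c₁-clique a~c₁) (λ l → sym₁ _ _ (X₁.h~u l))) v~
      where
      v~ : ∀ j → E G₁ X₁.v ((X₁.u ∷ a ∷ c₁) j)
      v~ zero    = sym₁ _ _ X₁.u~v
      v~ (suc j) = sym₁ _ _ (X₁.h~v j)

    g : Vector (Fin (n G)) 9
    g = f₂ X₂.u ∷ (f₁ ∘ K)

    g-injective : Injective _≡_ _≡_ g
    g-injective = ∷-injective (K-injective ∘ f₁-inj) λ r eq →
      let (l , _ , u₂≡c₂l) = meet (K r) X₂.u eq in X₂.h∌u (suc l) (sym u₂≡c₂l)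

    L-fresh : ∀ {u} → u ∈ List.[ f₂ b ] → ∀ p → g p ≢ u
    L-fresh (here refl) zero    eq = X₂.h∌u zero (sym (f₂-inj eq))
    L-fresh (here refl) (suc r) eq = let (l , _ , b≡c₂l) = meet (K r) b eq in c₂∌b l (sym b≡c₂l)

    open ExtendedEmbedding {K9-01-02} {G′} g g-injective (# 3) List.[ f₂ b ] L-fresh

    to-c : ∀ {u} → u ∈ List.[ f₂ b ] → PathIn G′ InBranchOfC u (f₁ a)
    to-c (here refl) = step (inj₁ (here refl)) (addEdge-yx G _ _) (here (inj₂ refl))

    u₂-edges : ∀ q → E K9-01-02 zero q → ∃ λ v → Branch q v × E G′ (f₂ X₂.u) v
    u₂-edges (suc (suc (suc zero)))      _ =
      f₂ b , inj₂ (refl , here refl) , addEdge-⊇ G _ _ _ _ (f₂-hom cs _ _ (sym₂ _ _ (X₂.h~u zero)))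
    u₂-edges (suc (suc (suc (suc l)))) _ =
      f₁ (c₁ l) , inj₁ refl ,
      addEdge-⊇ G _ _ _ _ (subst (E G (f₂ X₂.u)) (sym (glued l)) (f₂-hom cs _ _ (sym₂ _ _ (X₂.h~u (suc l)))))

    edges′ : ∀ p q → E K9-01-02 p q → ∃₂ λ u v → Branch p u × Branch q v × E G′ u v
    edges′ zero q e = let (v , qv , u₂v) = u₂-edges q e in f₂ X₂.u , v , inj₁ refl , qv , u₂v
    edges′ (suc p) zero e =
      let (v , pv , u₂v) = u₂-edges (suc p) (K9-01-02-undirected (suc p) zero e) in
      v , f₂ X₂.u , pv , inj₁ refl , addEdge-undirected G _ _ sym-G _ _ u₂v
    edges′ (suc p) (suc q) e =
      g (suc p) , g (suc q) , inj₁ refl , inj₁ refl ,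
      addEdge-⊇ G _ _ _ _ (f₁-hom cs _ _ (K-clique p q λ p≡q → K9-01-02-irreflexive _ _ e (cong suc p≡q)))

nonEdge-across : ∀ {G₁ G₂ G} (cs : CliqueSum 5 G₁ G₂ G) →
                 Cockade K8 K22222 5 G₁ → Cockade K8 K22222 5 G₂ →
                 NonEdgesForceK9= G₁ → NonEdgesForceK9= G₂ →
                 ∀ {a b} → Avoids (CliqueSum.c₁ cs) a → Avoids (CliqueSum.c₂ cs) b →
                 HasK9=Minor (addEdge G (CliqueSum.f₁ cs a) (CliqueSum.f₂ cs b))
nonEdge-across {G₁} {G₂} {G} cs C₁ C₂ ih₁ ih₂ {a} {b} c₁∌a c₂∌b
  with nonNeighbour⊎dominates G₁ a (CliqueSum.c₁ cs) | nonNeighbour⊎dominates G₂ b (CliqueSum.c₂ cs)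
... | inj₁ (i , a≁c₁i) | _ =
  HasK9=Minor-trans (reroute-minor cs (neighboursReachable C₂) (Cockade-undirected (glue C₁ C₂ cs)) a c₂∌b i)
                    (ih₁ a _ (λ eq → c₁∌a i (sym eq)) a≁c₁i)
... | inj₂ _ | inj₁ (i , b≁c₂i) =
  HasK9=Minor-addEdge-comm G _ _
    (HasK9=Minor-trans (reroute-minor (CliqueSum-flip cs) (neighboursReachable C₁)
                                      (Cockade-undirected (glue C₁ C₂ cs)) b c₁∌a i)
                       (ih₂ b _ (λ eq → c₂∌b i (sym eq)) b≁c₂i))
... | inj₂ a~c₁ | inj₂ b~c₂ = dominating-K9= cs C₁ C₂ c₁∌a c₂∌b a~c₁ b~c₂

nonEdge-cross : ∀ {G₁ G₂ G} (cs : CliqueSum 5 G₁ G₂ G) →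
                Cockade K8 K22222 5 G₁ → Cockade K8 K22222 5 G₂ →
                NonEdgesForceK9= G₁ → NonEdgesForceK9= G₂ →
                ∀ a b → let open CliqueSum cs in
                f₁ a ≢ f₂ b → adj G (f₁ a) (f₂ b) ≡ false → HasK9=Minor (addEdge G (f₁ a) (f₂ b))
nonEdge-cross cs C₁ C₂ ih₁ ih₂ a b x≢y x≁y
  with any? (λ l → CliqueSum.c₁ cs l ≟ a) | any? (λ l → CliqueSum.c₂ cs l ≟ b)
... | yes (l , refl) | _ = nonEdge-within (CliqueSum-flip cs) ih₂ (sym (CliqueSum.glued cs l)) refl x≢y x≁y
... | no _ | yes (l , refl) = nonEdge-within cs ih₁ refl (CliqueSum.glued cs l) x≢y x≁y
... | no a∉c₁ | no b∉c₂ = nonEdge-across cs C₁ C₂ ih₁ ih₂ (λ l eq → a∉c₁ (l , eq)) (λ l eq → b∉c₂ (l , eq))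

nonEdgesForceK9=-glue : ∀ {G₁ G₂ G} (cs : CliqueSum 5 G₁ G₂ G) →
                        Cockade K8 K22222 5 G₁ → Cockade K8 K22222 5 G₂ →
                        NonEdgesForceK9= G₁ → NonEdgesForceK9= G₂ → NonEdgesForceK9= G
nonEdgesForceK9=-glue cs C₁ C₂ ih₁ ih₂ x y x≢y x≁y with CliqueSum.cover cs x | CliqueSum.cover cs y
... | inj₁ (a , refl) | inj₁ (b , refl) = nonEdge-within cs ih₁ refl refl x≢y x≁y
... | inj₂ (a , refl) | inj₂ (b , refl) = nonEdge-within (CliqueSum-flip cs) ih₂ refl refl x≢y x≁y
... | inj₁ (a , refl) | inj₂ (b , refl) = nonEdge-cross cs C₁ C₂ ih₁ ih₂ a b x≢y x≁y
... | inj₂ (a , refl) | inj₁ (b , refl) = nonEdge-cross (CliqueSum-flip cs) C₂ C₁ ih₂ ih₁ a b x≢y x≁y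

nonEdgesForceK9= : ∀ {G} → Cockade K8 K22222 5 G → NonEdgesForceK9= G
nonEdgesForceK9= (base₁ I)       = K8-nonEdgesForceK9= I
nonEdgesForceK9= (base₂ I)       = K22222-nonEdgesForceK9= I
nonEdgesForceK9= (glue C₁ C₂ cs) = nonEdgesForceK9=-glue cs C₁ C₂ (nonEdgesForceK9= C₁) (nonEdgesForceK9= C₂)

lemma2p1 : (G : Graph) → Cockade K8 K22222 5 G →
           (x y : Fin (n G)) → x ≢ y → adj G x y ≡ false →
           HasK9=Minor (addEdge G x y)
lemma2p1 G C = nonEdgesForceK9= C
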